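{- Let $1\le k\le m\le n$ and $b\ge0$. In $\mathbb{K}[x_1,\dots,x_n]$, $$\mathsf{T}_{m-1}\mathsf{T}_{m-2}\cdots\mathsf{T}_k\,(x_k^{b})=h_b\big[x_m+(1-t)(x_k+x_{k+1}+\cdots+x_{m-1})\big],$$ where the product of operators is empty when $m=k$.
   Context: $\mathbb{K}=\mathbb{Q}(q,t)$. $\mathsf{T}_if=\frac{(t-1)x_if+(x_{i+1}-tx_i)s_i(f)}{x_{i+1}-x_i}$, with $s_i$ swapping $x_i$ and $x_{i+1}$. $h_b[A]$ denotes plethystic evaluation of the complete homogeneous symmetric function $h_b$, where $t$ is treated as a monomial: $p_r[x_m+(1-t)(x_k+\cdots+x_{m-1})]=x_m^r+(1-t^r)(x_k^r+\cdots+x_{m-1}^r)$. -}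

module Defs where

open import Data.Nat as ℕ using (ℕ; zero; suc; _∸_)
open import Data.Nat.Properties as ℕP using ()
open import Data.Integer as ℤ using (+_)
open import Data.Rational as ℚ using (ℚ; 0ℚ; 1ℚ)
open import Data.Rational.Properties as ℚP using ()
open import Data.Fin as Fin using (Fin; toℕ)
open import Data.Vec as Vec using (Vec; tabulate; lookup; replicate; zipWith)
open import Data.Vec.Properties using (≡-dec)
open import Data.List as List using (List; []; _∷_; _++_; map; concatMap; upTo)
open import Data.Product using (Σ; _×_; _,_; proj₁; proj₂)
open import Data.Bool using (if_then_else_)
open import Relation.Nullary using (yes; no)
open import Relation.Nullary.Decidable using (⌊_⌋)
open import Relation.Binary.PropositionalEquality using (_≡_)

-- A monomial t^d x^α is a pair (d , α) with α : Vec ℕ n  (α[j] = exponent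
-- of x_{j+1}).  A polynomial is a finite formal sum (list) of terms; two
-- polynomials are equal when all their coefficients agree.

Mono : ℕ → Set
Mono n = ℕ × Vec ℕ n

monoMul : ∀ {n} → Mono n → Mono n → Mono n
monoMul (d , α) (e , β) = (d ℕ.+ e , zipWith ℕ._+_ α β)

monoEq? : ∀ {n} (μ ν : Mono n) → _
monoEq? (d , α) (e , β) = ⌊ d ℕP.≟ e ⌋ Data.Bool.∧ ⌊ ≡-dec ℕP._≟_ α β ⌋
  where import Data.Bool

Poly : ℕ → Set
Poly n = List (ℚ × Mono n)

coeff : ∀ {n} → Poly n → Mono n → ℚ
coeff [] μ = 0ℚ
coeff ((c , ν) ∷ p) μ = (if monoEq? ν μ then c else 0ℚ) ℚ.+ coeff p μ

infix 4 _≈_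
_≈_ : ∀ {n} → Poly n → Poly n → Set
p ≈ q = ∀ μ → coeff p μ ≡ coeff q μ

infixl 6 _+P_ _-P_
infixl 7 _*P_

_+P_ : ∀ {n} → Poly n → Poly n → Poly n
p +P q = p ++ q

scale : ∀ {n} → ℚ → Poly n → Poly n
scale c p = map (λ { (a , μ) → (c ℚ.* a , μ) }) p

_-P_ : ∀ {n} → Poly n → Poly n → Poly n
p -P q = p ++ scale (ℚ.- 1ℚ) q

_*P_ : ∀ {n} → Poly n → Poly n → Poly n
p *P q = concatMap (λ { (a , μ) → map (λ { (b , ν) → (a ℚ.* b , monoMul μ ν) }) q }) p

zeroP : ∀ {n} → Poly n
zeroP = []

oneP : ∀ {n} → Poly n
oneP {n} = (1ℚ , (0 , replicate n 0)) ∷ []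

_^P_ : ∀ {n} → Poly n → ℕ → Poly n
p ^P zero = oneP
p ^P suc e = p *P (p ^P e)

tP : ∀ {n} → Poly n
tP {n} = (1ℚ , (1 , replicate n 0)) ∷ []

-- the variable x_i (1-based index i, meaningful for 1 ≤ i ≤ n)
x : ∀ {n} → ℕ → Poly n
x {n} i = (1ℚ , (0 , tabulate (λ j → if ⌊ suc (toℕ j) ℕP.≟ i ⌋ then 1 else 0))) ∷ []

-- s_i : swap x_i and x_{i+1} (1-based), acting on exponent vectors
swapIdx : ℕ → ℕ → ℕ
swapIdx i j = if ⌊ j ℕP.≟ i ⌋ then suc i else (if ⌊ j ℕP.≟ suc i ⌋ then i else j)

swapExp : ∀ {n} → ℕ → Vec ℕ n → Vec ℕ n
swapExp {n} i α =
  tabulate (λ j → pick (swapIdx i (suc (toℕ j))))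
  where
  pick : ℕ → ℕ
  pick r = List.foldr (λ j acc → if ⌊ suc (toℕ j) ℕP.≟ r ⌋ then lookup α j else acc) 0 (List.allFin n)

s : ∀ {n} → ℕ → Poly n → Poly n
s i p = map (λ { (c , (d , α)) → (c , (d , swapExp i α)) }) p

-- Demazure–Lusztig operator T_i (as a relation, since it is defined
-- through an exact quotient):
--   T_i f = g   iff   (x_{i+1} - x_i) g = (t-1) x_i f + (x_{i+1} - t x_i) s_i(f).
-- Since x_{i+1} - x_i is a non-zero-divisor, g is unique when it exists.

TIs : ∀ {n} → ℕ → Poly n → Poly n → Set
TIs i f g =
  (x (suc i) -P x i) *P g ≈
  (tP -P oneP) *P x i *P f +P (x (suc i) -P tP *P x i) *P s i f

-- TChain i c f g :  g = T_{i+c-1} ⋯ T_{i+1} T_i f   (g ≈ f when c = 0)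
TChain : ∀ {n} → ℕ → ℕ → Poly n → Poly n → Set
TChain i zero f g = g ≈ f
TChain i (suc c) f g = Σ (Poly _) λ h → TIs i f h × TChain (suc i) c h g

-- Plethystic evaluation at A = x_m + (1-t)(x_k + ⋯ + x_{m-1}).
-- p_r[A] = x_m^r + (1 - t^r)(x_k^r + ⋯ + x_{m-1}^r)

pA : ∀ {n} → ℕ → ℕ → ℕ → Poly n
pA k m r =
  x m ^P r +P (oneP -P tP ^P r) *P
    List.foldr (λ j acc → x j ^P r +P acc) zeroP (List.map (k ℕ.+_) (upTo (m ∸ k)))

-- hsA k m b = [h_b[A], h_{b-1}[A], …, h_0[A]], computed via Newton's identity
--   b h_b = Σ_{r=1}^{b} p_r h_{b-r}
-- (plethysm is a ring homomorphism Λ → ℚ(q,t)[x] determined by p_r ↦ p_r[A]).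
hsA : ∀ {n} → ℕ → ℕ → ℕ → List (Poly n)
hsA k m zero = oneP ∷ []
hsA k m (suc b) =
  scale ((+ 1) ℚ./ suc b)
    (List.foldr _+P_ zeroP
      (List.zipWith _*P_ (List.map (λ r → pA k m (suc r)) (upTo (suc b))) prev))
  ∷ prev
  where prev = hsA k m b

hA : ∀ {n} → ℕ → ℕ → ℕ → Poly n
hA k m b with hsA k m b
... | [] = zeroP
... | h ∷ _ = h

{-# OPTIONS --safe #-}
-- Write h[A] for the sequence b ↦ h_b[A] and A_{k,m} = x_m + (1 - t)(x_k + ⋯ + x_{m-1}).
-- Over ℚ, h[A] is the unique sequence with h_0 = 1 satisfying Newton's identities
-- b·h_b = ∑_{r=1}^{b} p_r[A] h_{b-r}. Hence adding a letter y to the alphabet gives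
-- h_b[A + y] = y·h_{b-1}[A + y] + h_b[A], and removing a letter w gives
-- h_b[A - w] = h_b[A] - w·h_{b-1}[A]. Since A_{k,i+1} = A_{k,i} - t x_i + x_{i+1} and
-- s_i A_{k,i} = A_{k,i} - x_i + x_{i+1}, both h[A_{k,i+1}] and s_i h[A_{k,i}] arise from
-- h[A_{k,i}] in this way, and an induction on b shows
--   (x_{i+1} - x_i)·h_b[A - t x_i + x_{i+1}]
--     = (t - 1) x_i·h_b[A] + (x_{i+1} - t x_i)·h_b[A - x_i + x_{i+1}],
-- that is, T_i h_b[A_{k,i}] = h_b[A_{k,i+1}]. Starting from h_b[A_{k,k}] = x_k^b, induction
-- on m concludes.
module Submission where

open import Defs hiding (_≈_)
import Defs

open import Algebra.Bundles using (CommutativeRing; CommutativeMonoid; Ring; Semiring; RawSemiring)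
open import Algebra.Morphism.Structures using (module SemiringMorphisms)
open import Algebra.Solver.Ring.AlmostCommutativeRing using (fromCommutativeRing; _-Raw-AlmostCommutative⟶_)
open import Algebra.Structures using (IsCommutativeRing)
import Algebra.Definitions.RawMonoid as RawMonoidDefinitions
import Algebra.Definitions.RawSemiring as RawSemiringDefinitions
import Algebra.Properties.CommutativeSemigroup as CommutativeSemigroupProperties
import Algebra.Properties.Ring as RingProperties
import Algebra.Properties.CommutativeSemiring.Exp as CommutativeSemiringExp
import Algebra.Properties.Semiring.Exp as SemiringExp
open import Data.List.Relation.Unary.All using (All; []; _∷_)
import Data.List.Relation.Unary.All.Properties as AllProperties
open import Data.Bool using (true; false; if_then_else_)
open import Data.Fin as Fin using (Fin; toℕ)
open import Data.Integer as ℤ using (+_)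
import Data.Integer.Properties as ℤ
open import Data.List as List using (List; []; _∷_; _++_; map; concatMap; upTo)
import Data.List.Properties as List
open import Data.Maybe using (Maybe; just; nothing)
open import Data.Nat as ℕ using (ℕ; zero; suc; _≤_; _<_; _∸_; z≤n; s≤s)
import Data.Nat.Coprimality as Coprime
import Data.Nat.Properties as ℕ
import Data.Product as Product
open import Data.Product using (_,_; proj₁; proj₂; ∃-syntax)
open import Data.Product.Properties using () renaming (≡-dec to ×-≡-dec)
open import Data.Rational as ℚ using (ℚ; mkℚ; 0ℚ; 1ℚ)
import Data.Rational.Properties as ℚ
import Data.Rational.Unnormalised as ℚᵘ
import Data.Rational.Unnormalised.Properties as ℚᵘ
open import Data.Sum using (_⊎_; inj₁; inj₂)
open import Data.Vec as Vec using (Vec; []; _∷_; replicate; zipWith; tabulate; lookup)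
import Data.Vec.Properties as Vec
open import Data.Vec.Properties using () renaming (≡-dec to Vec-≡-dec)
open import Data.Vec.Relation.Binary.Pointwise.Inductive as Pointwise using (Pointwise-≡⇒≡)
open import Function using (_∘_)
open import Function.Bundles using (_⇔_; Equivalence; mk⇔)
open import Level using (0ℓ)
open import Relation.Binary.Definitions using (DecidableEquality)
open import Relation.Binary.PropositionalEquality as ≡ using (_≡_; _≢_)
import Relation.Binary.Reasoning.Setoid as SetoidReasoning
open import Relation.Nullary using (Dec; yes; no; contradiction)
open import Relation.Nullary.Decidable using (⌊_⌋; dec-true; dec-false; isYes≗does; does-⇔)

open SemiringMorphisms using (IsSemiringHomomorphism)

open RawMonoidDefinitions ℚ.+-0-rawMonoid using () renaming (_×_ to _×ℚ_)

-- Newton sequences in ℚ-algebras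

fromℕ : ℕ → ℚ
fromℕ m = mkℚ (+ m) 0 (Coprime.sym (Coprime.1-coprimeTo m))

×1ℚ≡fromℕ : ∀ m → m ×ℚ 1ℚ ≡ fromℕ m
×1ℚ≡fromℕ zero = ≡.refl
×1ℚ≡fromℕ (suc m) = ≡.trans (≡.cong (1ℚ ℚ.+_) (×1ℚ≡fromℕ m)) (ℚ.toℚᵘ-injective
  (ℚᵘ.≃-trans (ℚ.toℚᵘ-homo-+ 1ℚ (fromℕ m))
    (ℚᵘ.*≡* (≡.cong (λ z → (+ 1 ℤ.+ z) ℤ.* + 1) (ℤ.*-identityʳ (+ m))))))

1/[1+b]*[1+b]≡1 : ∀ b → ((+ 1) ℚ./ suc b) ℚ.* (suc b ×ℚ 1ℚ) ≡ 1ℚ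
1/[1+b]*[1+b]≡1 b = ≡.trans
  (≡.cong₂ ℚ._*_ (ℚ.normalize-coprime (Coprime.1-coprimeTo (suc b))) (×1ℚ≡fromℕ (suc b)))
  (ℚ.*-inverseˡ (fromℕ (suc b)))

rawSemiringOf : ∀ {r ℓ} → Ring r ℓ → RawSemiring r ℓ
rawSemiringOf R = Semiring.rawSemiring (Ring.semiring R)

module RationalAlgebra {r ℓ} (R : CommutativeRing r ℓ)
  (ι : ℚ.+-*-rawRing -Raw-AlmostCommutative⟶ fromCommutativeRing R) where

  open CommutativeRing R
  open _-Raw-AlmostCommutative⟶_ ι
  open RawSemiringDefinitions (rawSemiringOf ring) using (_×_; _^_) public
  open SetoidReasoning setoid

  coefficient-≟ : (a b : ℚ) → Maybe (⟦ a ⟧ ≈ ⟦ b ⟧)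
  coefficient-≟ a b with a ℚ.≟ b
  ... | yes ≡.refl = just refl
  ... | no _ = nothing

  open import Algebra.Solver.Ring ℚ.+-*-rawRing (fromCommutativeRing R) ι coefficient-≟
    using (solve; _:=_; _:+_; _:*_; _:-_; :-_; con) public

  ⟦⟧-×ℚ : ∀ m → ⟦ m ×ℚ 1ℚ ⟧ ≈ m × 1#
  ⟦⟧-×ℚ zero = 0-homo
  ⟦⟧-×ℚ (suc m) = trans (+-homo 1ℚ (m ×ℚ 1ℚ)) (+-cong 1-homo (⟦⟧-×ℚ m))

  ⟦1/[1+b]⟧*[1+b]≈1 : ∀ b → ⟦ (+ 1) ℚ./ suc b ⟧ * (suc b × 1#) ≈ 1#
  ⟦1/[1+b]⟧*[1+b]≈1 b = begin
    ⟦ c ⟧ * (suc b × 1#)        ≈⟨ *-congˡ (⟦⟧-×ℚ (suc b)) ⟨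
    ⟦ c ⟧ * ⟦ suc b ×ℚ 1ℚ ⟧     ≈⟨ *-homo c (suc b ×ℚ 1ℚ) ⟨
    ⟦ c ℚ.* (suc b ×ℚ 1ℚ) ⟧     ≡⟨ ≡.cong ⟦_⟧ (1/[1+b]*[1+b]≡1 b) ⟩
    ⟦ 1ℚ ⟧                      ≈⟨ 1-homo ⟩
    1# ∎
    where
    c : ℚ
    c = (+ 1) ℚ./ suc b

  ×1-cancelˡ : ∀ b {u v} → (suc b × 1#) * u ≈ (suc b × 1#) * v → u ≈ v
  ×1-cancelˡ b {u} {v} eq = begin
    u                              ≈⟨ *-identityˡ u ⟨
    1# * u                         ≈⟨ *-congʳ (⟦1/[1+b]⟧*[1+b]≈1 b) ⟨
    ⟦ c ⟧ * (suc b × 1#) * u       ≈⟨ *-assoc _ _ u ⟩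
    ⟦ c ⟧ * ((suc b × 1#) * u)     ≈⟨ *-congˡ eq ⟩
    ⟦ c ⟧ * ((suc b × 1#) * v)     ≈⟨ *-assoc _ _ v ⟨
    ⟦ c ⟧ * (suc b × 1#) * v       ≈⟨ *-congʳ (⟦1/[1+b]⟧*[1+b]≈1 b) ⟩
    1# * v                         ≈⟨ *-identityˡ v ⟩
    v ∎
    where
    c : ℚ
    c = (+ 1) ℚ./ suc b

module SemiringHomomorphismProperties {r ℓ} (R : Ring r ℓ) (f : Ring.Carrier R → Ring.Carrier R)
  (f-homo : IsSemiringHomomorphism (rawSemiringOf R) (rawSemiringOf R) f) where

  open Ring R
  open IsSemiringHomomorphism f-homo
  open RawSemiringDefinitions (rawSemiringOf R) using (_×_; _^_)
  open SetoidReasoning setoid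

  ×1-homo : ∀ b → f (b × 1#) ≈ b × 1#
  ×1-homo zero = 0#-homo
  ×1-homo (suc b) = trans (+-homo 1# (b × 1#)) (+-cong 1#-homo (×1-homo b))

  ^-homo : ∀ a r → f (a ^ r) ≈ f a ^ r
  ^-homo a zero = 1#-homo
  ^-homo a (suc r) = trans (*-homo a (a ^ r)) (*-congˡ (^-homo a r))

  -‿homo : ∀ a → f (- a) ≈ - f a
  -‿homo a = begin
    f (- a)                   ≈⟨ +-identityʳ (f (- a)) ⟨
    f (- a) + 0#              ≈⟨ +-congˡ (-‿inverseʳ (f a)) ⟨
    f (- a) + (f a - f a)     ≈⟨ +-assoc (f (- a)) (f a) (- f a) ⟨
    f (- a) + f a - f a       ≈⟨ +-congʳ (+-homo (- a) a) ⟨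
    f (- a + a) - f a         ≈⟨ +-congʳ (trans (⟦⟧-cong (-‿inverseˡ a)) 0#-homo) ⟩
    0# - f a                  ≈⟨ +-identityˡ (- f a) ⟩
    - f a ∎

module NewtonSequences {r ℓ} (R : CommutativeRing r ℓ)
  (ι : ℚ.+-*-rawRing -Raw-AlmostCommutative⟶ fromCommutativeRing R) where

  open CommutativeRing R hiding (zero)
  open RationalAlgebra R ι
  open RingProperties ring using (-0#≈0#)
  open SetoidReasoning setoid

  -- newtonSum p h b = ∑_{r < b} p r * h (b - 1 - r); p r stands for the power sum p_{r+1}.
  newtonSum : (ℕ → Carrier) → (ℕ → Carrier) → ℕ → Carrier
  newtonSum p h zero = 0#
  newtonSum p h (suc b) = p 0 * h b + newtonSum (p ∘ suc) h b

  record IsNewton (p h : ℕ → Carrier) : Set ℓ where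
    field
      initial : h 0 ≈ 1#
      identity : ∀ b → (b × 1#) * h b ≈ newtonSum p h b

  newtonSum-congˡ : ∀ {p q} → (∀ r → p r ≈ q r) → ∀ h b → newtonSum p h b ≈ newtonSum q h b
  newtonSum-congˡ p≈q h zero = refl
  newtonSum-congˡ p≈q h (suc b) = +-cong (*-congʳ (p≈q 0)) (newtonSum-congˡ (p≈q ∘ suc) h b)

  newtonSum-congʳ : ∀ p b {g h} → (∀ j → j < b → g j ≈ h j) → newtonSum p g b ≈ newtonSum p h b
  newtonSum-congʳ p zero g≈h = refl
  newtonSum-congʳ p (suc b) g≈h =
    +-cong (*-congˡ (g≈h b ℕ.≤-refl)) (newtonSum-congʳ (p ∘ suc) b (λ j j<b → g≈h j (ℕ.m≤n⇒m≤1+n j<b)))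

  newtonSum-+ˡ : ∀ p q h b → newtonSum (λ r → p r + q r) h b ≈ newtonSum p h b + newtonSum q h b
  newtonSum-+ˡ p q h zero = sym (+-identityˡ 0#)
  newtonSum-+ˡ p q h (suc b) = begin
    (p 0 + q 0) * h b + newtonSum (λ r → p (suc r) + q (suc r)) h b
      ≈⟨ +-congˡ (newtonSum-+ˡ (p ∘ suc) (q ∘ suc) h b) ⟩
    (p 0 + q 0) * h b + (newtonSum (p ∘ suc) h b + newtonSum (q ∘ suc) h b)
      ≈⟨ solve 5 (λ P Q H S T → (P :+ Q) :* H :+ (S :+ T) := (P :* H :+ S) :+ (Q :* H :+ T)) refl
           (p 0) (q 0) (h b) (newtonSum (p ∘ suc) h b) (newtonSum (q ∘ suc) h b) ⟩
    newtonSum p h (suc b) + newtonSum q h (suc b) ∎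

  newtonSum-*ˡ : ∀ a p h b → newtonSum (λ r → a * p r) h b ≈ a * newtonSum p h b
  newtonSum-*ˡ a p h zero = sym (zeroʳ a)
  newtonSum-*ˡ a p h (suc b) = begin
    a * p 0 * h b + newtonSum (λ r → a * p (suc r)) h b ≈⟨ +-congˡ (newtonSum-*ˡ a (p ∘ suc) h b) ⟩
    a * p 0 * h b + a * newtonSum (p ∘ suc) h b         ≈⟨ +-congʳ (*-assoc a (p 0) (h b)) ⟩
    a * (p 0 * h b) + a * newtonSum (p ∘ suc) h b       ≈⟨ distribˡ a _ _ ⟨
    a * newtonSum p h (suc b) ∎

  newtonSum-negateˡ : ∀ p h b → newtonSum (λ r → - p r) h b ≈ - newtonSum p h b
  newtonSum-negateˡ p h zero = sym -0#≈0#
  newtonSum-negateˡ p h (suc b) = begin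
    - p 0 * h b + newtonSum (λ r → - p (suc r)) h b ≈⟨ +-congˡ (newtonSum-negateˡ (p ∘ suc) h b) ⟩
    - p 0 * h b + - newtonSum (p ∘ suc) h b         ≈⟨ solve 3 (λ P H S → (:- P) :* H :+ (:- S) := :- (P :* H :+ S)) refl
                                                          (p 0) (h b) (newtonSum (p ∘ suc) h b) ⟩
    - newtonSum p h (suc b) ∎

  newtonSum-linearʳ : ∀ p a g h b →
    newtonSum p (λ j → a * g j + h j) b ≈ a * newtonSum p g b + newtonSum p h b
  newtonSum-linearʳ p a g h zero = sym (trans (+-identityʳ _) (zeroʳ a))
  newtonSum-linearʳ p a g h (suc b) = begin
    p 0 * (a * g b + h b) + newtonSum (p ∘ suc) (λ j → a * g j + h j) b
      ≈⟨ +-congˡ (newtonSum-linearʳ (p ∘ suc) a g h b) ⟩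
    p 0 * (a * g b + h b) + (a * newtonSum (p ∘ suc) g b + newtonSum (p ∘ suc) h b)
      ≈⟨ solve 6 (λ P A G H S T → P :* (A :* G :+ H) :+ (A :* S :+ T) := A :* (P :* G :+ S) :+ (P :* H :+ T)) refl
           (p 0) a (g b) (h b) (newtonSum (p ∘ suc) g b) (newtonSum (p ∘ suc) h b) ⟩
    a * newtonSum p g (suc b) + newtonSum p h (suc b) ∎

  shift : (ℕ → Carrier) → ℕ → Carrier
  shift h zero = 0#
  shift h (suc j) = h j

  newtonSum-shift : ∀ p h b → newtonSum p (shift h) (suc b) ≈ newtonSum p h b
  newtonSum-shift p h zero = trans (+-identityʳ _) (zeroʳ (p 0))
  newtonSum-shift p h (suc b) = +-congˡ (newtonSum-shift (p ∘ suc) h b)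

  newtonSum-powers : ∀ y h b →
    newtonSum (λ r → y ^ suc r) h (suc b) ≈ y * (h b + newtonSum (λ r → y ^ suc r) h b)
  newtonSum-powers y h b = begin
    y * 1# * h b + newtonSum (λ r → y * y ^ suc r) h b ≈⟨ +-cong (*-congʳ (*-identityʳ y)) (newtonSum-*ˡ y _ h b) ⟩
    y * h b + y * newtonSum (λ r → y ^ suc r) h b      ≈⟨ distribˡ y _ _ ⟨
    y * (h b + newtonSum (λ r → y ^ suc r) h b) ∎

  -- For h = h[A]: withLetter y h = h[A + y] and withoutLetter w h = h[A - w].
  withLetter : Carrier → (ℕ → Carrier) → ℕ → Carrier
  withLetter y h zero = h zero
  withLetter y h (suc b) = y * withLetter y h b + h (suc b)

  withoutLetter : Carrier → (ℕ → Carrier) → ℕ → Carrier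
  withoutLetter w h zero = h zero
  withoutLetter w h (suc b) = h (suc b) - w * h b

  withLetter-newton : ∀ {p h} y → IsNewton p h → IsNewton (λ r → p r + y ^ suc r) (withLetter y h)
  withLetter-newton {p} {h} y newton = record { initial = initial ; identity = identity′ }
    where
    open IsNewton newton
    g Y : ℕ → Carrier
    g = withLetter y h
    Y r = y ^ suc r

    newtonSum-p : ∀ b → newtonSum p g (suc b) ≈ y * newtonSum p g b + (suc b × 1#) * h (suc b)
    newtonSum-p b = begin
      newtonSum p g (suc b)
        ≈⟨ newtonSum-congʳ p (suc b) g≈ ⟩
      newtonSum p (λ j → y * shift g j + h j) (suc b)
        ≈⟨ newtonSum-linearʳ p y (shift g) h (suc b) ⟩
      y * newtonSum p (shift g) (suc b) + newtonSum p h (suc b)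
        ≈⟨ +-cong (*-congˡ (newtonSum-shift p g b)) (sym (identity (suc b))) ⟩
      y * newtonSum p g b + (suc b × 1#) * h (suc b) ∎
      where
      g≈ : ∀ j → j < suc b → g j ≈ y * shift g j + h j
      g≈ zero _ = sym (trans (+-congʳ (zeroʳ y)) (+-identityˡ (h 0)))
      g≈ (suc j) _ = refl

    identity′ : ∀ b → (b × 1#) * g b ≈ newtonSum (λ r → p r + Y r) g b
    identity′ zero = zeroˡ (h 0)
    -- 1# enters the solver as a variable O, since con 1ℚ denotes ⟦ 1ℚ ⟧ rather than 1#.
    identity′ (suc b) = begin
      (1# + b × 1#) * (y * g b + h (suc b))
        ≈⟨ solve 5 (λ O N Y G H → (O :+ N) :* (Y :* G :+ H) := Y :* (N :* G) :+ Y :* (O :* G) :+ (O :+ N) :* H) refl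
             1# (b × 1#) y (g b) (h (suc b)) ⟩
      y * ((b × 1#) * g b) + y * (1# * g b) + (suc b × 1#) * h (suc b)
        ≈⟨ +-congʳ (+-cong (*-congˡ (trans (identity′ b) (newtonSum-+ˡ p Y g b))) (*-congˡ (*-identityˡ (g b)))) ⟩
      y * (newtonSum p g b + newtonSum Y g b) + y * g b + (suc b × 1#) * h (suc b)
        ≈⟨ solve 6 (λ Y G H N S T → Y :* (S :+ T) :+ Y :* G :+ N :* H := (Y :* S :+ N :* H) :+ Y :* (G :+ T)) refl
             y (g b) (h (suc b)) (suc b × 1#) (newtonSum p g b) (newtonSum Y g b) ⟩
      (y * newtonSum p g b + (suc b × 1#) * h (suc b)) + y * (g b + newtonSum Y g b)
        ≈⟨ +-cong (newtonSum-p b) (newtonSum-powers y g b) ⟨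
      newtonSum p g (suc b) + newtonSum Y g (suc b)
        ≈⟨ newtonSum-+ˡ p Y g (suc b) ⟨
      newtonSum (λ r → p r + Y r) g (suc b) ∎

  withoutLetter-newton : ∀ {p h} w → IsNewton p h → IsNewton (λ r → p r - w ^ suc r) (withoutLetter w h)
  withoutLetter-newton {p} {h} w newton = record { initial = initial ; identity = identity′ }
    where
    open IsNewton newton
    g W : ℕ → Carrier
    g = withoutLetter w h
    W r = w ^ suc r

    newtonSum-W : ∀ b → newtonSum W g (suc b) ≈ w * h b
    newtonSum-W zero = trans (newtonSum-powers w g 0) (*-congˡ (+-identityʳ (h 0)))
    newtonSum-W (suc b) = begin
      newtonSum W g (suc (suc b))              ≈⟨ newtonSum-powers w g (suc b) ⟩
      w * (g (suc b) + newtonSum W g (suc b))  ≈⟨ *-congˡ (+-congˡ (newtonSum-W b)) ⟩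
      w * (h (suc b) - w * h b + w * h b)
        ≈⟨ *-congˡ (solve 2 (λ H V → H :- V :+ V := H) refl (h (suc b)) (w * h b)) ⟩
      w * h (suc b) ∎

    newtonSum-p : ∀ b → newtonSum p g (suc b) ≈ - w * ((b × 1#) * h b) + (suc b × 1#) * h (suc b)
    newtonSum-p b = begin
      newtonSum p g (suc b)
        ≈⟨ newtonSum-congʳ p (suc b) g≈ ⟩
      newtonSum p (λ j → - w * shift h j + h j) (suc b)
        ≈⟨ newtonSum-linearʳ p (- w) (shift h) h (suc b) ⟩
      - w * newtonSum p (shift h) (suc b) + newtonSum p h (suc b)
        ≈⟨ +-cong (*-congˡ (trans (newtonSum-shift p h b) (sym (identity b)))) (sym (identity (suc b))) ⟩
      - w * ((b × 1#) * h b) + (suc b × 1#) * h (suc b) ∎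
      where
      g≈ : ∀ j → j < suc b → g j ≈ - w * shift h j + h j
      g≈ zero _ = sym (trans (+-congʳ (zeroʳ (- w))) (+-identityˡ (h 0)))
      g≈ (suc j) _ = solve 3 (λ W H1 H0 → H1 :- W :* H0 := (:- W) :* H0 :+ H1) refl w (h (suc j)) (h j)

    identity′ : ∀ b → (b × 1#) * g b ≈ newtonSum (λ r → p r - W r) g b
    identity′ zero = zeroˡ (h 0)
    identity′ (suc b) = begin
      (1# + b × 1#) * (h (suc b) - w * h b)
        ≈⟨ solve 5 (λ O N W H1 H0 → (O :+ N) :* (H1 :- W :* H0)
                                   := ((:- W) :* (N :* H0) :+ (O :+ N) :* H1) :- W :* (O :* H0)) refl
             1# (b × 1#) w (h (suc b)) (h b) ⟩
      (- w * ((b × 1#) * h b) + (suc b × 1#) * h (suc b)) - w * (1# * h b)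
        ≈⟨ +-cong (sym (newtonSum-p b)) (-‿cong (trans (*-congˡ (*-identityˡ (h b))) (sym (newtonSum-W b)))) ⟩
      newtonSum p g (suc b) - newtonSum W g (suc b)
        ≈⟨ +-congˡ (newtonSum-negateˡ W g (suc b)) ⟨
      newtonSum p g (suc b) + newtonSum (λ r → - W r) g (suc b)
        ≈⟨ newtonSum-+ˡ p (λ r → - W r) g (suc b) ⟨
      newtonSum (λ r → p r - W r) g (suc b) ∎

  emptyAlphabet : ℕ → Carrier
  emptyAlphabet zero = 1#
  emptyAlphabet (suc b) = 0#

  emptyAlphabet-newton : IsNewton (λ _ → 0#) emptyAlphabet
  emptyAlphabet-newton = record { initial = refl ; identity = identity }
    where
    newtonSum-0 : ∀ h b → newtonSum (λ _ → 0#) h b ≈ 0#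
    newtonSum-0 h zero = refl
    newtonSum-0 h (suc b) = trans (+-cong (zeroˡ (h b)) (newtonSum-0 h b)) (+-identityˡ 0#)
    identity : ∀ b → (b × 1#) * emptyAlphabet b ≈ newtonSum (λ _ → 0#) emptyAlphabet b
    identity zero = zeroˡ 1#
    identity (suc b) = trans (zeroʳ _) (sym (newtonSum-0 emptyAlphabet (suc b)))

  withLetter-emptyAlphabet : ∀ y b → withLetter y emptyAlphabet b ≈ y ^ b
  withLetter-emptyAlphabet y zero = refl
  withLetter-emptyAlphabet y (suc b) = trans (+-identityʳ _) (*-congˡ (withLetter-emptyAlphabet y b))

  -- Newton's identities determine h b from h 0, …, h (b - 1) since b is invertible.
  newton-unique : ∀ {p q g h} → (∀ r → p r ≈ q r) → IsNewton p g → IsNewton q h → ∀ b → g b ≈ h b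
  newton-unique {p} {q} {g} {h} p≈q newton-g newton-h b = next b (agree b)
    where
    module G = IsNewton newton-g
    module H = IsNewton newton-h

    next : ∀ b → (∀ j → j < b → g j ≈ h j) → g b ≈ h b
    next zero _ = trans G.initial (sym H.initial)
    next (suc b) g≈h = ×1-cancelˡ b (begin
      (suc b × 1#) * g (suc b)  ≈⟨ G.identity (suc b) ⟩
      newtonSum p g (suc b)     ≈⟨ newtonSum-congˡ p≈q g (suc b) ⟩
      newtonSum q g (suc b)     ≈⟨ newtonSum-congʳ q (suc b) g≈h ⟩
      newtonSum q h (suc b)     ≈⟨ H.identity (suc b) ⟨
      (suc b × 1#) * h (suc b) ∎)

    agree : ∀ b j → j < b → g j ≈ h j
    agree (suc b) j j<1+b with ℕ.m<1+n⇒m<n∨m≡n j<1+b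
    ... | inj₁ j<b = agree b j j<b
    ... | inj₂ ≡.refl = next b (agree b)

  module _ (f : Carrier → Carrier) (f-homo : IsSemiringHomomorphism (rawSemiringOf ring) (rawSemiringOf ring) f) where
    open IsSemiringHomomorphism f-homo
    open SemiringHomomorphismProperties ring f f-homo using (×1-homo)

    newtonSum-homo : ∀ p h b → f (newtonSum p h b) ≈ newtonSum (f ∘ p) (f ∘ h) b
    newtonSum-homo p h zero = 0#-homo
    newtonSum-homo p h (suc b) =
      trans (+-homo _ _) (+-cong (*-homo (p 0) (h b)) (newtonSum-homo (p ∘ suc) h b))

    newton-homo : ∀ {p h} → IsNewton p h → IsNewton (f ∘ p) (f ∘ h)
    newton-homo {p} {h} newton = record
      { initial = trans (⟦⟧-cong initial) 1#-homo
      ; identity = λ b → begin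
          (b × 1#) * f (h b)      ≈⟨ *-congʳ (×1-homo b) ⟨
          f (b × 1#) * f (h b)    ≈⟨ *-homo (b × 1#) (h b) ⟨
          f ((b × 1#) * h b)      ≈⟨ ⟦⟧-cong (identity b) ⟩
          f (newtonSum p h b)     ≈⟨ newtonSum-homo p h b ⟩
          newtonSum (f ∘ p) (f ∘ h) b ∎
      }
      where open IsNewton newton

  -- For x = x_i, y = x_{i+1} and w = t x_i this is the relation defining T_i.
  letter-exchange : ∀ x y w h b →
    (y - x) * withLetter y (withoutLetter w h) b ≈ (w - x) * h b + (y - w) * withLetter y (withoutLetter x h) b
  letter-exchange x y w h zero =
    solve 4 (λ X Y W H → (Y :- X) :* H := (W :- X) :* H :+ (Y :- W) :* H) refl x y w (h 0)
  letter-exchange x y w h (suc b) = begin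
    (y - x) * (y * A b + (h (suc b) - w * h b))
      ≈⟨ solve 6 (λ X Y W A H1 H0 → (Y :- X) :* (Y :* A :+ (H1 :- W :* H0))
                                  := Y :* ((Y :- X) :* A) :+ (Y :- X) :* (H1 :- W :* H0)) refl
           x y w (A b) (h (suc b)) (h b) ⟩
    y * ((y - x) * A b) + (y - x) * (h (suc b) - w * h b)
      ≈⟨ +-congʳ (*-congˡ (letter-exchange x y w h b)) ⟩
    y * ((w - x) * h b + (y - w) * B b) + (y - x) * (h (suc b) - w * h b)
      ≈⟨ solve 6 (λ X Y W B H1 H0 → Y :* ((W :- X) :* H0 :+ (Y :- W) :* B) :+ (Y :- X) :* (H1 :- W :* H0)
                                  := (W :- X) :* H1 :+ (Y :- W) :* (Y :* B :+ (H1 :- X :* H0))) refl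
           x y w (B b) (h (suc b)) (h b) ⟩
    (w - x) * h (suc b) + (y - w) * (y * B b + (h (suc b) - x * h b)) ∎
    where
    A B : ℕ → Carrier
    A = withLetter y (withoutLetter w h)
    B = withLetter y (withoutLetter x h)

-- Polynomials and their coefficients

sumOver : {A : Set} → List A → (A → ℚ) → ℚ
sumOver [] f = 0ℚ
sumOver (a ∷ as) f = f a ℚ.+ sumOver as f

module _ {A : Set} where

  open CommutativeSemigroupProperties (CommutativeMonoid.commutativeSemigroup ℚ.+-0-commutativeMonoid)
    using () renaming (interchange to +-interchange)

  sumOver-++ : ∀ (as bs : List A) f → sumOver (as ++ bs) f ≡ sumOver as f ℚ.+ sumOver bs f
  sumOver-++ [] bs f = ≡.sym (ℚ.+-identityˡ _)
  sumOver-++ (a ∷ as) bs f = ≡.trans (≡.cong (f a ℚ.+_) (sumOver-++ as bs f)) (≡.sym (ℚ.+-assoc (f a) _ _))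

  sumOver-cong : ∀ (as : List A) {f g} → (∀ a → f a ≡ g a) → sumOver as f ≡ sumOver as g
  sumOver-cong [] f≡g = ≡.refl
  sumOver-cong (a ∷ as) f≡g = ≡.cong₂ ℚ._+_ (f≡g a) (sumOver-cong as f≡g)

  sumOver-0 : ∀ (as : List A) → sumOver as (λ _ → 0ℚ) ≡ 0ℚ
  sumOver-0 [] = ≡.refl
  sumOver-0 (a ∷ as) = ≡.trans (ℚ.+-identityˡ _) (sumOver-0 as)

  sumOver-*ˡ : ∀ (as : List A) c f → sumOver as (λ a → c ℚ.* f a) ≡ c ℚ.* sumOver as f
  sumOver-*ˡ [] c f = ≡.sym (ℚ.*-zeroʳ c)
  sumOver-*ˡ (a ∷ as) c f = ≡.trans (≡.cong (c ℚ.* f a ℚ.+_) (sumOver-*ˡ as c f)) (≡.sym (ℚ.*-distribˡ-+ c _ _))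

  sumOver-+ : ∀ (as : List A) f g → sumOver as (λ a → f a ℚ.+ g a) ≡ sumOver as f ℚ.+ sumOver as g
  sumOver-+ [] f g = ≡.sym (ℚ.+-identityˡ 0ℚ)
  sumOver-+ (a ∷ as) f g = ≡.trans (≡.cong (f a ℚ.+ g a ℚ.+_) (sumOver-+ as f g))
    (+-interchange (f a) (g a) _ _)

  sumOver-map : ∀ {B : Set} (g : B → A) (bs : List B) f → sumOver (map g bs) f ≡ sumOver bs (f ∘ g)
  sumOver-map g [] f = ≡.refl
  sumOver-map g (b ∷ bs) f = ≡.cong (f (g b) ℚ.+_) (sumOver-map g bs f)

  sumOver-concatMap : ∀ {B : Set} (g : B → List A) (bs : List B) f →
    sumOver (concatMap g bs) f ≡ sumOver bs (λ b → sumOver (g b) f)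
  sumOver-concatMap g [] f = ≡.refl
  sumOver-concatMap g (b ∷ bs) f =
    ≡.trans (sumOver-++ (g b) (concatMap g bs) f) (≡.cong (sumOver (g b) f ℚ.+_) (sumOver-concatMap g bs f))

sumOver-comm : ∀ {A B : Set} (as : List A) (bs : List B) (F : A → B → ℚ) →
  sumOver as (λ a → sumOver bs (F a)) ≡ sumOver bs (λ b → sumOver as (λ a → F a b))
sumOver-comm [] bs F = ≡.sym (sumOver-0 bs)
sumOver-comm (a ∷ as) bs F = ≡.trans (≡.cong (sumOver bs (F a) ℚ.+_) (sumOver-comm as bs F))
  (≡.sym (sumOver-+ bs (F a) (λ b → sumOver as (λ a′ → F a′ b))))

_⊕_ : ∀ {n} → Vec ℕ n → Vec ℕ n → Vec ℕ n
_⊕_ = zipWith ℕ._+_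

⊕-comm : ∀ {n} (α β : Vec ℕ n) → α ⊕ β ≡ β ⊕ α
⊕-comm α β = Pointwise-≡⇒≡ (Pointwise.zipWith-comm ℕ.+-comm α β)

⊕-assoc : ∀ {n} (α β γ : Vec ℕ n) → (α ⊕ β) ⊕ γ ≡ α ⊕ (β ⊕ γ)
⊕-assoc α β γ = Pointwise-≡⇒≡ (Pointwise.zipWith-assoc ℕ.+-assoc α β γ)

⊕-identityˡ : ∀ {n} (α : Vec ℕ n) → replicate n 0 ⊕ α ≡ α
⊕-identityˡ α = Pointwise-≡⇒≡ (Pointwise.zipWith-identityˡ ℕ.+-identityˡ α)

⊕-cancelˡ : ∀ {n} (ρ α β : Vec ℕ n) → ρ ⊕ α ≡ ρ ⊕ β → α ≡ β
⊕-cancelˡ [] [] [] _ = ≡.refl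
⊕-cancelˡ (r ∷ ρ) (a ∷ α) (b ∷ β) eq =
  ≡.cong₂ _∷_ (ℕ.+-cancelˡ-≡ r a b (≡.cong Vec.head eq)) (⊕-cancelˡ ρ α β (≡.cong Vec.tail eq))

⊕-divides? : ∀ {n} (ρ μ : Vec ℕ n) → (∃[ ν ] ρ ⊕ ν ≡ μ) ⊎ (∀ ν → ρ ⊕ ν ≢ μ)
⊕-divides? [] [] = inj₁ ([] , ≡.refl)
⊕-divides? (r ∷ ρ) (m ∷ μ) with r ℕ.≤? m | ⊕-divides? ρ μ
... | yes r≤m | inj₁ (ν , eq) = inj₁ (m ∸ r ∷ ν , ≡.cong₂ _∷_ (ℕ.m+[n∸m]≡n r≤m) eq)
... | no r≰m  | _             =
  inj₂ λ { (a ∷ ν) eq → r≰m (≡.subst (r ℕ.≤_) (≡.cong Vec.head eq) (ℕ.m≤m+n r a)) }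
... | yes _   | inj₂ ρ∤μ      = inj₂ λ { (a ∷ ν) eq → ρ∤μ ν (≡.cong Vec.tail eq) }

monoOne : ∀ {n} → Mono n
monoOne {n} = (0 , replicate n 0)

monoMul-comm : ∀ {n} (μ ν : Mono n) → monoMul μ ν ≡ monoMul ν μ
monoMul-comm (d , α) (e , β) = ≡.cong₂ _,_ (ℕ.+-comm d e) (⊕-comm α β)

monoMul-assoc : ∀ {n} (μ ν ρ : Mono n) → monoMul (monoMul μ ν) ρ ≡ monoMul μ (monoMul ν ρ)
monoMul-assoc (d , α) (e , β) (f , γ) = ≡.cong₂ _,_ (ℕ.+-assoc d e f) (⊕-assoc α β γ)

monoMul-identityˡ : ∀ {n} (μ : Mono n) → monoMul monoOne μ ≡ μ
monoMul-identityˡ (d , α) = ≡.cong (d ,_) (⊕-identityˡ α)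

monoMul-cancelˡ : ∀ {n} (ρ μ ν : Mono n) → monoMul ρ μ ≡ monoMul ρ ν → μ ≡ ν
monoMul-cancelˡ (r , ρ) (d , α) (e , β) eq =
  ≡.cong₂ _,_ (ℕ.+-cancelˡ-≡ r d e (≡.cong proj₁ eq)) (⊕-cancelˡ ρ α β (≡.cong proj₂ eq))

monoMul-divides? : ∀ {n} (ρ μ : Mono n) → (∃[ ν ] monoMul ρ ν ≡ μ) ⊎ (∀ ν → monoMul ρ ν ≢ μ)
monoMul-divides? (r , ρ) (m , μ) with r ℕ.≤? m | ⊕-divides? ρ μ
... | yes r≤m | inj₁ (ν , eq) = inj₁ ((m ∸ r , ν) , ≡.cong₂ _,_ (ℕ.m+[n∸m]≡n r≤m) eq)
... | no r≰m  | _             =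
  inj₂ λ { (a , ν) eq → r≰m (≡.subst (r ℕ.≤_) (≡.cong proj₁ eq) (ℕ.m≤m+n r a)) }
... | yes _   | inj₂ ρ∤μ      = inj₂ λ { (a , ν) eq → ρ∤μ ν (≡.cong proj₂ eq) }

_≟ₘ_ : ∀ {n} → DecidableEquality (Mono n)
_≟ₘ_ = ×-≡-dec ℕ._≟_ (Vec-≡-dec ℕ._≟_)

δ : ∀ {n} → Mono n → Mono n → ℚ → ℚ
δ ν μ c = if monoEq? ν μ then c else 0ℚ

δ-refl : ∀ {n} (μ : Mono n) c → δ μ μ c ≡ c
δ-refl (d , α) c with d ℕ.≟ d | Vec-≡-dec ℕ._≟_ α α
... | yes _ | yes _   = ≡.refl
... | no d≢d | _      = contradiction ≡.refl d≢d
... | yes _ | no α≢α  = contradiction ≡.refl α≢α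

δ-≢ : ∀ {n} (ν μ : Mono n) c → ν ≢ μ → δ ν μ c ≡ 0ℚ
δ-≢ (d , α) (e , β) c ν≢μ with d ℕ.≟ e | Vec-≡-dec ℕ._≟_ α β
... | yes ≡.refl | yes ≡.refl = contradiction ≡.refl ν≢μ
... | no _       | _          = ≡.refl
... | yes _      | no _       = ≡.refl

δ-resp : ∀ {n} {ν ν′ μ μ′ : Mono n} → (ν ≡ μ ⇔ ν′ ≡ μ′) → ∀ c → δ ν μ c ≡ δ ν′ μ′ c
δ-resp {ν = ν} {ν′} {μ} {μ′} ν≡μ⇔ν′≡μ′ c with ν ≟ₘ μ
... | yes ≡.refl =
  ≡.trans (δ-refl ν c) (≡.sym (≡.subst (λ z → δ ν′ z c ≡ c) (Equivalence.to ν≡μ⇔ν′≡μ′ ≡.refl) (δ-refl ν′ c)))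
... | no ν≢μ =
  ≡.trans (δ-≢ ν μ c ν≢μ) (≡.sym (δ-≢ ν′ μ′ c (ν≢μ ∘ Equivalence.from ν≡μ⇔ν′≡μ′)))

δ-* : ∀ {n} (ν μ : Mono n) a b → δ ν μ (a ℚ.* b) ≡ a ℚ.* δ ν μ b
δ-* ν μ a b with monoEq? ν μ
... | true  = ≡.refl
... | false = ≡.sym (ℚ.*-zeroʳ a)

δ-+ : ∀ {n} (ν μ : Mono n) a b → δ ν μ (a ℚ.+ b) ≡ δ ν μ a ℚ.+ δ ν μ b
δ-+ ν μ a b with monoEq? ν μ
... | true  = ≡.refl
... | false = ≡.refl

δ-0 : ∀ {n} (ν μ : Mono n) → δ ν μ 0ℚ ≡ 0ℚ
δ-0 ν μ with monoEq? ν μ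
... | true  = ≡.refl
... | false = ≡.refl

Term : ℕ → Set
Term n = ℚ Product.× Mono n

contribution : ∀ {n} → Mono n → Term n → ℚ
contribution μ (c , ν) = δ ν μ c

coeff-sumOver : ∀ {n} (p : Poly n) μ → coeff p μ ≡ sumOver p (contribution μ)
coeff-sumOver [] μ = ≡.refl
coeff-sumOver ((c , ν) ∷ p) μ = ≡.cong (δ ν μ c ℚ.+_) (coeff-sumOver p μ)

coeff-++ : ∀ {n} (p q : Poly n) μ → coeff (p ++ q) μ ≡ coeff p μ ℚ.+ coeff q μ
coeff-++ p q μ = ≡.trans (coeff-sumOver (p ++ q) μ)
  (≡.trans (sumOver-++ p q _) (≡.sym (≡.cong₂ ℚ._+_ (coeff-sumOver p μ) (coeff-sumOver q μ))))

coeff-scale : ∀ {n} c (p : Poly n) μ → coeff (scale c p) μ ≡ c ℚ.* coeff p μ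
coeff-scale c [] μ = ≡.sym (ℚ.*-zeroʳ c)
coeff-scale c ((a , ν) ∷ p) μ =
  ≡.trans (≡.cong₂ ℚ._+_ (δ-* ν μ c a) (coeff-scale c p μ)) (≡.sym (ℚ.*-distribˡ-+ c _ _))

sumOver-*P : ∀ {n} (p q : Poly n) (F : Term n → ℚ) →
  sumOver (p *P q) F ≡ sumOver p (λ (a , μ) → sumOver q (λ (b , ν) → F (a ℚ.* b , monoMul μ ν)))
sumOver-*P p q F = ≡.trans (sumOver-concatMap _ p F) (sumOver-cong p (λ _ → sumOver-map _ q F))

coeff-*P : ∀ {n} (p q : Poly n) μ →
  coeff (p *P q) μ ≡ sumOver p (λ (a , ρ) → sumOver q (λ (b , ν) → δ (monoMul ρ ν) μ (a ℚ.* b)))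
coeff-*P p q μ = ≡.trans (coeff-sumOver (p *P q) μ) (sumOver-*P p q (contribution μ))

-- The coefficient of μ in ρ·q: it is coeff q (μ / ρ) when ρ divides μ, and 0 otherwise.
shiftedCoeff : ∀ {n} → Mono n → Poly n → Mono n → ℚ
shiftedCoeff ρ q μ = sumOver q (λ (b , ν) → δ (monoMul ρ ν) μ b)

shiftedCoeff-cong : ∀ {n} {q q′ : Poly n} → q Defs.≈ q′ → ∀ ρ μ → shiftedCoeff ρ q μ ≡ shiftedCoeff ρ q′ μ
shiftedCoeff-cong {q = q} {q′} q≈q′ ρ μ with monoMul-divides? ρ μ
... | inj₁ (μ/ρ , ρ·μ/ρ≡μ) = ≡.trans (quotient q) (≡.trans (q≈q′ μ/ρ) (≡.sym (quotient q′)))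
  where
  quotient : ∀ q → shiftedCoeff ρ q μ ≡ coeff q μ/ρ
  quotient q = ≡.trans (sumOver-cong q (λ (b , ν) → δ-resp
      (mk⇔ (λ eq → monoMul-cancelˡ ρ ν μ/ρ (≡.trans eq (≡.sym ρ·μ/ρ≡μ)))
           (λ eq → ≡.trans (≡.cong (monoMul ρ) eq) ρ·μ/ρ≡μ)) b))
    (≡.sym (coeff-sumOver q μ/ρ))
... | inj₂ ρ∤μ = ≡.trans (vanishes q) (≡.sym (vanishes q′))
  where
  vanishes : ∀ q → shiftedCoeff ρ q μ ≡ 0ℚ
  vanishes q = ≡.trans (sumOver-cong q (λ (b , ν) → δ-≢ _ μ b (ρ∤μ ν))) (sumOver-0 q)

coeff-*P-shifted : ∀ {n} (p q : Poly n) μ →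
  coeff (p *P q) μ ≡ sumOver p (λ (a , ρ) → a ℚ.* shiftedCoeff ρ q μ)
coeff-*P-shifted p q μ = ≡.trans (coeff-*P p q μ) (sumOver-cong p (λ (a , ρ) →
  ≡.trans (sumOver-cong q (λ (b , ν) → δ-* (monoMul ρ ν) μ a b)) (sumOver-*ˡ q a _)))

-- Coefficientwise equality as a record, so that both sides can be inferred from the type.
infix 4 _≋_
record _≋_ {n : ℕ} (p q : Poly n) : Set where
  constructor coeffwise
  field coeff-≡ : p Defs.≈ q
open _≋_

module PolynomialRing (n : ℕ) where

  P : Set
  P = Poly n

  -- so that the ring's p - q is definitionally p -P q
  -P_ : P → P
  -P_ = scale (ℚ.- 1ℚ)

  ≋-refl : ∀ {p : P} → p ≋ p
  ≋-refl = coeffwise (λ _ → ≡.refl)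

  ≋-sym : ∀ {p q : P} → p ≋ q → q ≋ p
  ≋-sym (coeffwise eq) = coeffwise (λ μ → ≡.sym (eq μ))

  ≋-trans : ∀ {p q r : P} → p ≋ q → q ≋ r → p ≋ r
  ≋-trans (coeffwise eq) (coeffwise eq′) = coeffwise (λ μ → ≡.trans (eq μ) (eq′ μ))

  ≡⇒≋ : ∀ {p q : P} → p ≡ q → p ≋ q
  ≡⇒≋ ≡.refl = ≋-refl

  +-cong : ∀ {p p′ q q′ : P} → p ≋ p′ → q ≋ q′ → p +P q ≋ p′ +P q′
  +-cong {p} {p′} {q} {q′} (coeffwise eq) (coeffwise eq′) = coeffwise λ μ → begin
    coeff (p ++ q) μ          ≡⟨ coeff-++ p q μ ⟩
    coeff p μ ℚ.+ coeff q μ   ≡⟨ ≡.cong₂ ℚ._+_ (eq μ) (eq′ μ) ⟩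
    coeff p′ μ ℚ.+ coeff q′ μ ≡⟨ coeff-++ p′ q′ μ ⟨
    coeff (p′ ++ q′) μ        ∎
    where open ≡.≡-Reasoning

  +-congˡ : ∀ (p : P) {q q′} → q ≋ q′ → p +P q ≋ p +P q′
  +-congˡ p = +-cong (≋-refl {p})

  +-congʳ : ∀ (q : P) {p p′} → p ≋ p′ → p +P q ≋ p′ +P q
  +-congʳ q p≋p′ = +-cong p≋p′ (≋-refl {q})

  +-assoc : ∀ (p q r : P) → (p +P q) +P r ≋ p +P (q +P r)
  +-assoc p q r = ≡⇒≋ (List.++-assoc p q r)

  +-comm : ∀ (p q : P) → p +P q ≋ q +P p
  +-comm p q = coeffwise λ μ →
    ≡.trans (coeff-++ p q μ) (≡.trans (ℚ.+-comm (coeff p μ) (coeff q μ)) (≡.sym (coeff-++ q p μ)))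

  +-identityʳ : ∀ (p : P) → p +P zeroP ≋ p
  +-identityʳ p = ≡⇒≋ (List.++-identityʳ p)

  -‿cong : ∀ {p q : P} → p ≋ q → -P p ≋ -P q
  -‿cong {p} {q} (coeffwise eq) = coeffwise λ μ →
    ≡.trans (coeff-scale (ℚ.- 1ℚ) p μ)
            (≡.trans (≡.cong (ℚ.- 1ℚ ℚ.*_) (eq μ)) (≡.sym (coeff-scale (ℚ.- 1ℚ) q μ)))

  -‿inverseˡ : ∀ (p : P) → -P p +P p ≋ zeroP
  -‿inverseˡ p = coeffwise λ μ → begin
    coeff (-P p ++ p) μ                           ≡⟨ coeff-++ (-P p) p μ ⟩
    coeff (-P p) μ ℚ.+ coeff p μ                  ≡⟨ ≡.cong (ℚ._+ coeff p μ) (coeff-scale (ℚ.- 1ℚ) p μ) ⟩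
    (ℚ.- 1ℚ) ℚ.* coeff p μ ℚ.+ coeff p μ          ≡⟨ ≡.cong (ℚ._+ coeff p μ) (-1*x≈-x (coeff p μ)) ⟩
    ℚ.- coeff p μ ℚ.+ coeff p μ                   ≡⟨ ℚ.+-inverseˡ (coeff p μ) ⟩
    0ℚ                                            ∎
    where
    open ≡.≡-Reasoning
    open RingProperties ℚ.+-*-ring using (-1*x≈-x)

  -‿inverseʳ : ∀ (p : P) → p +P -P p ≋ zeroP
  -‿inverseʳ p = ≋-trans (+-comm p (-P p)) (-‿inverseˡ p)

  *-comm : ∀ (p q : P) → p *P q ≋ q *P p
  *-comm p q = coeffwise λ μ → ≡.trans (coeff-*P p q μ) (≡.trans (sumOver-comm p q _) (≡.trans
    (sumOver-cong q λ (b , ρ) → sumOver-cong p λ (a , ν) →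
      ≡.cong₂ (λ m c → δ m μ c) (monoMul-comm ν ρ) (ℚ.*-comm a b))
    (≡.sym (coeff-*P q p μ))))

  *-congˡ : ∀ (p : P) {q q′ : P} → q ≋ q′ → p *P q ≋ p *P q′
  *-congˡ p {q} {q′} (coeffwise eq) = coeffwise λ μ → ≡.trans (coeff-*P-shifted p q μ) (≡.trans
    (sumOver-cong p (λ (a , ρ) → ≡.cong (a ℚ.*_) (shiftedCoeff-cong {q = q} {q′} eq ρ μ)))
    (≡.sym (coeff-*P-shifted p q′ μ)))

  *-cong : ∀ {p p′ q q′ : P} → p ≋ p′ → q ≋ q′ → p *P q ≋ p′ *P q′
  *-cong {p} {p′} {q} {q′} p≋p′ q≋q′ =
    ≋-trans (*-congˡ p q≋q′) (≋-trans (*-comm p q′) (≋-trans (*-congˡ q′ p≋p′) (*-comm q′ p′)))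

  *-assoc : ∀ (p q r : P) → (p *P q) *P r ≋ p *P (q *P r)
  *-assoc p q r = coeffwise λ μ → ≡.trans (coeff-*P (p *P q) r μ) (≡.trans (sumOver-*P p q _) (≡.trans
    (sumOver-cong p λ (a , ν) → ≡.trans
      (sumOver-cong q λ (b , ρ) → sumOver-cong r λ (c , σ) →
        ≡.cong₂ (λ m x → δ m μ x) (monoMul-assoc ν ρ σ) (ℚ.*-assoc a b c))
      (≡.sym (sumOver-*P q r _)))
    (≡.sym (coeff-*P p (q *P r) μ))))

  *-identityˡ : ∀ (p : P) → oneP *P p ≋ p
  *-identityˡ p = coeffwise λ μ → ≡.trans (coeff-*P oneP p μ) (≡.trans (ℚ.+-identityʳ _) (≡.trans
    (sumOver-cong p (λ (b , ρ) → ≡.cong₂ (λ m x → δ m μ x) (monoMul-identityˡ ρ) (ℚ.*-identityˡ b)))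
    (≡.sym (coeff-sumOver p μ))))

  *-identityʳ : ∀ (p : P) → p *P oneP ≋ p
  *-identityʳ p = ≋-trans (*-comm p oneP) (*-identityˡ p)

  distribʳ : ∀ (p q r : P) → (q +P r) *P p ≋ q *P p +P r *P p
  distribʳ p q r = coeffwise λ μ → ≡.trans (coeff-*P (q +P r) p μ) (≡.trans (sumOver-++ q r _)
    (≡.trans (≡.cong₂ ℚ._+_ (≡.sym (coeff-*P q p μ)) (≡.sym (coeff-*P r p μ)))
             (≡.sym (coeff-++ (q *P p) (r *P p) μ))))

  distribˡ : ∀ (p q r : P) → p *P (q +P r) ≋ p *P q +P p *P r
  distribˡ p q r = ≋-trans (*-comm p (q +P r)) (≋-trans (distribʳ p q r) (+-cong (*-comm q p) (*-comm r p)))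

  isCommutativeRing : IsCommutativeRing _≋_ _+P_ _*P_ -P_ zeroP oneP
  isCommutativeRing = record
    { isRing = record
      { +-isAbelianGroup = record
        { isGroup = record
          { isMonoid = record
            { isSemigroup = record
              { isMagma = record
                { isEquivalence = record { refl = ≋-refl ; sym = ≋-sym ; trans = ≋-trans }
                ; ∙-cong = +-cong }
              ; assoc = +-assoc }
            ; identity = (λ _ → ≋-refl) , +-identityʳ }
          ; inverse = -‿inverseˡ , -‿inverseʳ
          ; ⁻¹-cong = -‿cong }
        ; comm = +-comm }
      ; *-cong = *-cong
      ; *-assoc = *-assoc
      ; *-identity = *-identityˡ , *-identityʳ
      ; distrib = distribˡ , distribʳ }
    ; *-comm = *-comm }

  commutativeRing : CommutativeRing 0ℓ 0ℓ
  commutativeRing = record { isCommutativeRing = isCommutativeRing }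

  -- constant 1ℚ is literally oneP, so the solver's con 1ℚ stands for oneP.
  constant : ℚ → P
  constant c = (c , monoOne) ∷ []

  constant-homo : ℚ.+-*-rawRing -Raw-AlmostCommutative⟶ fromCommutativeRing commutativeRing
  constant-homo = record
    { ⟦_⟧ = constant
    ; +-homo = λ a b → coeffwise λ μ →
        ≡.trans (ℚ.+-identityʳ _)
                (≡.trans (δ-+ monoOne μ a b) (≡.cong (δ monoOne μ a ℚ.+_) (≡.sym (ℚ.+-identityʳ _))))
    ; *-homo = λ a b → coeffwise λ μ →
        ≡.trans (≡.cong (ℚ._+ 0ℚ) (≡.trans (≡.cong (λ m → δ m μ (a ℚ.* b)) (≡.sym (monoMul-identityˡ monoOne)))
                                         (≡.sym (ℚ.+-identityʳ _))))
                (≡.sym (coeff-*P (constant a) (constant b) μ))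
    ; -‿homo = λ a → coeffwise λ μ → ≡.cong (λ c → δ monoOne μ c ℚ.+ 0ℚ) (≡.sym (-1*x≈-x a))
    ; 0-homo = coeffwise λ μ → ≡.trans (ℚ.+-identityʳ _) (δ-0 monoOne μ)
    ; 1-homo = ≋-refl
    }
    where open RingProperties ℚ.+-*-ring using (-1*x≈-x)

  scale-constant : ∀ c (p : P) → scale c p ≋ constant c *P p
  scale-constant c p = coeffwise λ μ → ≡.trans (coeff-scale c p μ) (≡.sym (≡.trans (coeff-*P (constant c) p μ)
    (≡.trans (ℚ.+-identityʳ _) (≡.trans
      (sumOver-cong p (λ (b , ρ) → ≡.trans (≡.cong (λ m → δ m μ (c ℚ.* b)) (monoMul-identityˡ ρ)) (δ-* ρ μ c b)))
      (≡.trans (sumOver-*ˡ p c _) (≡.cong (c ℚ.*_) (≡.sym (coeff-sumOver p μ))))))))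

-- The transposition s_i

-- at α r is the exponent of x_r in α, for 1 ≤ r ≤ n, and 0 for any other r.
at : ∀ {n} → Vec ℕ n → ℕ → ℕ
at [] r = 0
at (a ∷ α) zero = 0
at (a ∷ α) (suc zero) = a
at (a ∷ α) (suc (suc r)) = at α (suc r)

at-ext : ∀ {n} (α β : Vec ℕ n) → (∀ r → 1 ≤ r → r ≤ n → at α r ≡ at β r) → α ≡ β
at-ext [] [] _ = ≡.refl
at-ext (a ∷ α) (b ∷ β) eq = ≡.cong₂ _∷_ (eq 1 (s≤s z≤n) (s≤s z≤n)) (at-ext α β eq′)
  where
  eq′ : ∀ r → 1 ≤ r → r ≤ _ → at α r ≡ at β r
  eq′ (suc r) _ r<n = eq (suc (suc r)) (s≤s z≤n) (s≤s r<n)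

at-⊕ : ∀ {n} (α β : Vec ℕ n) r → at (α ⊕ β) r ≡ at α r ℕ.+ at β r
at-⊕ [] [] r = ≡.refl
at-⊕ (a ∷ α) (b ∷ β) zero = ≡.refl
at-⊕ (a ∷ α) (b ∷ β) (suc zero) = ≡.refl
at-⊕ (a ∷ α) (b ∷ β) (suc (suc r)) = at-⊕ α β (suc r)

at-replicate : ∀ n r → at (replicate n 0) r ≡ 0
at-replicate zero r = ≡.refl
at-replicate (suc n) zero = ≡.refl
at-replicate (suc n) (suc zero) = ≡.refl
at-replicate (suc n) (suc (suc r)) = at-replicate n (suc r)

at-tabulate : ∀ {n} (G : ℕ → ℕ) r → 1 ≤ r → r ≤ n → at (tabulate {n = n} (λ l → G (suc (toℕ l)))) r ≡ G r
at-tabulate G (suc zero) _ (s≤s _) = ≡.refl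
at-tabulate {suc n} G (suc (suc r)) _ (s≤s r<n) = at-tabulate (G ∘ suc) (suc r) (s≤s z≤n) r<n

at-zero : ∀ {n} (α : Vec ℕ n) → at α 0 ≡ 0
at-zero [] = ≡.refl
at-zero (a ∷ α) = ≡.refl

foldr-allFin-suc : ∀ {n} {B : Set} (f : Fin (suc n) → B → B) e →
  List.foldr f e (List.tabulate Fin.suc) ≡ List.foldr (f ∘ Fin.suc) e (List.allFin n)
foldr-allFin-suc {n} f e =
  ≡.trans (≡.cong (List.foldr f e) (≡.sym (List.map-tabulate (λ j → j) Fin.suc)))
          (List.foldr-map f Fin.suc e (List.allFin n))

search-at : ∀ {n} (w : Fin n → ℕ) r →
  List.foldr (λ j acc → if suc (toℕ j) ℕ.≡ᵇ r then w j else acc) 0 (List.allFin n) ≡ at (tabulate w) r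
search-at {zero} w r = ≡.refl
search-at {suc n} w zero = ≡.trans (foldr-allFin-suc {n} (λ j acc → if suc (toℕ j) ℕ.≡ᵇ 0 then w j else acc) 0)
  (≡.trans (search-at (w ∘ Fin.suc) zero) (at-zero (tabulate (w ∘ Fin.suc))))
search-at {suc n} w (suc zero) = ≡.refl
search-at {suc n} w (suc (suc r)) =
  ≡.trans (foldr-allFin-suc {n} (λ j acc → if suc (toℕ j) ℕ.≡ᵇ suc (suc r) then w j else acc) 0)
          (search-at (w ∘ Fin.suc) (suc r))

swapExp-tabulate : ∀ {n} i (α : Vec ℕ n) → swapExp i α ≡ tabulate (λ l → at α (swapIdx i (suc (toℕ l))))
swapExp-tabulate {n} i α = Vec.tabulate-cong λ l → let r = swapIdx i (suc (toℕ l)) in ≡.trans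
  (List.foldr-cong (λ j acc → ≡.cong (λ b → if b then lookup α j else acc) (isYes≗does (suc (toℕ j) ℕ.≟ r)))
                   ≡.refl (List.allFin n))
  (≡.trans (search-at (lookup α) r) (≡.cong (λ v → at v r) (Vec.tabulate∘lookup α)))

at-swapExp : ∀ {n} i (α : Vec ℕ n) r → 1 ≤ r → r ≤ n → at (swapExp i α) r ≡ at α (swapIdx i r)
at-swapExp i α r 1≤r r≤n =
  ≡.trans (≡.cong (λ v → at v r) (swapExp-tabulate i α)) (at-tabulate (λ r → at α (swapIdx i r)) r 1≤r r≤n)

swapIdx-i : ∀ i → swapIdx i i ≡ suc i
swapIdx-i i rewrite isYes≗does (i ℕ.≟ i) | dec-true (i ℕ.≟ i) ≡.refl = ≡.refl

swapIdx-suc : ∀ i → swapIdx i (suc i) ≡ i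
swapIdx-suc i rewrite isYes≗does (suc i ℕ.≟ i) | dec-false (suc i ℕ.≟ i) ℕ.1+n≢n
                    | isYes≗does (suc i ℕ.≟ suc i) | dec-true (suc i ℕ.≟ suc i) ≡.refl = ≡.refl

swapIdx-other : ∀ i j → j ≢ i → j ≢ suc i → swapIdx i j ≡ j
swapIdx-other i j j≢i j≢1+i rewrite isYes≗does (j ℕ.≟ i) | dec-false (j ℕ.≟ i) j≢i
                                  | isYes≗does (j ℕ.≟ suc i) | dec-false (j ℕ.≟ suc i) j≢1+i = ≡.refl

swapIdx-involutive : ∀ i j → swapIdx i (swapIdx i j) ≡ j
swapIdx-involutive i j = cases (j ℕ.≟ i) (j ℕ.≟ suc i)
  where
  σ : ℕ → ℕ
  σ = swapIdx i
  cases : Dec (j ≡ i) → Dec (j ≡ suc i) → σ (σ j) ≡ j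
  cases (yes j≡i) _ = ≡.subst (λ r → σ (σ r) ≡ r) (≡.sym j≡i) (≡.trans (≡.cong σ (swapIdx-i i)) (swapIdx-suc i))
  cases (no _) (yes j≡1+i) =
    ≡.subst (λ r → σ (σ r) ≡ r) (≡.sym j≡1+i) (≡.trans (≡.cong σ (swapIdx-suc i)) (swapIdx-i i))
  cases (no j≢i) (no j≢1+i) = ≡.trans (≡.cong σ (swapIdx-other i j j≢i j≢1+i)) (swapIdx-other i j j≢i j≢1+i)

⌊⌋-⇔ : ∀ {A B : Set} → A ⇔ B → (a? : Dec A) (b? : Dec B) → ⌊ a? ⌋ ≡ ⌊ b? ⌋
⌊⌋-⇔ A⇔B a? b? = ≡.trans (isYes≗does a?) (≡.trans (does-⇔ A⇔B a? b?) (≡.sym (isYes≗does b?)))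

-- swapExp i permutes the exponent vectors only when both x_i and x_{i+1} exist.
module Swap {n i : ℕ} (1≤i : 1 ≤ i) (i<n : suc i ≤ n) where

  swapIdx-inRange : ∀ r → 1 ≤ r → r ≤ n → 1 ≤ swapIdx i r Product.× swapIdx i r ≤ n
  swapIdx-inRange r 1≤r r≤n = cases (r ℕ.≟ i) (r ℕ.≟ suc i)
    where
    inRange : ℕ → Set
    inRange j = 1 ≤ j Product.× j ≤ n
    cases : Dec (r ≡ i) → Dec (r ≡ suc i) → inRange (swapIdx i r)
    cases (yes r≡i) _ =
      ≡.subst (inRange ∘ swapIdx i) (≡.sym r≡i) (≡.subst inRange (≡.sym (swapIdx-i i)) (s≤s z≤n , i<n))
    cases (no _) (yes r≡1+i) =
      ≡.subst (inRange ∘ swapIdx i) (≡.sym r≡1+i) (≡.subst inRange (≡.sym (swapIdx-suc i)) (1≤i , ℕ.<⇒≤ i<n))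
    cases (no r≢i) (no r≢1+i) = ≡.subst inRange (≡.sym (swapIdx-other i r r≢i r≢1+i)) (1≤r , r≤n)

  at-swapExp-swapIdx : ∀ (α : Vec ℕ n) r → 1 ≤ r → r ≤ n → at (swapExp i α) (swapIdx i r) ≡ at α r
  at-swapExp-swapIdx α r 1≤r r≤n =
    ≡.trans (at-swapExp i α (swapIdx i r) 1≤σr σr≤n) (≡.cong (at α) (swapIdx-involutive i r))
    where open Product.Σ (swapIdx-inRange r 1≤r r≤n) renaming (proj₁ to 1≤σr; proj₂ to σr≤n)

  swapExp-involutive : ∀ (α : Vec ℕ n) → swapExp i (swapExp i α) ≡ α
  swapExp-involutive α = at-ext _ α λ r 1≤r r≤n →
    ≡.trans (at-swapExp i (swapExp i α) r 1≤r r≤n) (at-swapExp-swapIdx α r 1≤r r≤n)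

  swapExp-⊕ : ∀ (α β : Vec ℕ n) → swapExp i (α ⊕ β) ≡ swapExp i α ⊕ swapExp i β
  swapExp-⊕ α β = at-ext _ _ λ r 1≤r r≤n → begin
    at (swapExp i (α ⊕ β)) r                        ≡⟨ at-swapExp i (α ⊕ β) r 1≤r r≤n ⟩
    at (α ⊕ β) (swapIdx i r)                        ≡⟨ at-⊕ α β (swapIdx i r) ⟩
    at α (swapIdx i r) ℕ.+ at β (swapIdx i r)
      ≡⟨ ≡.cong₂ ℕ._+_ (at-swapExp i α r 1≤r r≤n) (at-swapExp i β r 1≤r r≤n) ⟨
    at (swapExp i α) r ℕ.+ at (swapExp i β) r       ≡⟨ at-⊕ (swapExp i α) (swapExp i β) r ⟨
    at (swapExp i α ⊕ swapExp i β) r ∎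
    where open ≡.≡-Reasoning

  swapExp-replicate : swapExp i (replicate n 0) ≡ replicate n 0
  swapExp-replicate = at-ext _ _ λ r 1≤r r≤n →
    ≡.trans (at-swapExp i (replicate n 0) r 1≤r r≤n)
            (≡.trans (at-replicate n (swapIdx i r)) (≡.sym (at-replicate n r)))

  unitExp : ℕ → Vec ℕ n
  unitExp j = tabulate (λ l → if ⌊ suc (toℕ l) ℕ.≟ j ⌋ then 1 else 0)

  swapExp-unitExp : ∀ j → swapExp i (unitExp j) ≡ unitExp (swapIdx i j)
  swapExp-unitExp j = at-ext _ _ pointwise
    where
    open ≡.≡-Reasoning
    σr≡j⇔r≡σj : ∀ r → swapIdx i r ≡ j ⇔ r ≡ swapIdx i j
    σr≡j⇔r≡σj r = mk⇔ (λ eq → ≡.trans (≡.sym (swapIdx-involutive i r)) (≡.cong (swapIdx i) eq))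
                       (λ eq → ≡.trans (≡.cong (swapIdx i) eq) (swapIdx-involutive i j))
    pointwise : ∀ r → 1 ≤ r → r ≤ n → at (swapExp i (unitExp j)) r ≡ at (unitExp (swapIdx i j)) r
    pointwise r 1≤r r≤n = begin
      at (swapExp i (unitExp j)) r
        ≡⟨ at-swapExp i (unitExp j) r 1≤r r≤n ⟩
      at (unitExp j) (swapIdx i r)
        ≡⟨ at-tabulate (λ r → if ⌊ r ℕ.≟ j ⌋ then 1 else 0) (swapIdx i r) 1≤σr σr≤n ⟩
      (if ⌊ swapIdx i r ℕ.≟ j ⌋ then 1 else 0)
        ≡⟨ ≡.cong (if_then 1 else 0) (⌊⌋-⇔ (σr≡j⇔r≡σj r) (swapIdx i r ℕ.≟ j) (r ℕ.≟ swapIdx i j)) ⟩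
      (if ⌊ r ℕ.≟ swapIdx i j ⌋ then 1 else 0)
        ≡⟨ at-tabulate (λ r → if ⌊ r ℕ.≟ swapIdx i j ⌋ then 1 else 0) r 1≤r r≤n ⟨
      at (unitExp (swapIdx i j)) r ∎
      where open Product.Σ (swapIdx-inRange r 1≤r r≤n) renaming (proj₁ to 1≤σr; proj₂ to σr≤n)

  open PolynomialRing n
  open CommutativeRing commutativeRing using (ring)

  swapMono : Mono n → Mono n
  swapMono (d , α) = (d , swapExp i α)

  coeff-s : ∀ (p : P) μ → coeff (s i p) μ ≡ coeff p (swapMono μ)
  coeff-s p (e , β) = ≡.trans (coeff-sumOver (s i p) (e , β)) (≡.trans (sumOver-map _ p (contribution (e , β)))
    (≡.trans (sumOver-cong p (λ (c , d , α) → δ-resp (mk⇔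
        (λ eq → ≡.cong₂ _,_ (≡.cong proj₁ eq)
                   (≡.trans (≡.sym (swapExp-involutive α)) (≡.cong (swapExp i ∘ proj₂) eq)))
        (λ eq → ≡.cong₂ _,_ (≡.cong proj₁ eq)
                   (≡.trans (≡.cong (swapExp i ∘ proj₂) eq) (swapExp-involutive β)))) c))
      (≡.sym (coeff-sumOver p (swapMono (e , β))))))

  s-cong : ∀ {p q : P} → p ≋ q → s i p ≋ s i q
  s-cong {p} {q} (coeffwise eq) = coeffwise λ μ →
    ≡.trans (coeff-s p μ) (≡.trans (eq (swapMono μ)) (≡.sym (coeff-s q μ)))

  s-+ : ∀ (p q : P) → s i (p +P q) ≋ s i p +P s i q
  s-+ p q = ≡⇒≋ (List.map-++ _ p q)

  s-* : ∀ (p q : P) → s i (p *P q) ≋ s i p *P s i q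
  s-* p q = coeffwise λ μ → ≡.trans (coeff-sumOver (s i (p *P q)) μ) (≡.trans (sumOver-map _ (p *P q) _)
    (≡.trans (sumOver-*P p q _) (≡.sym (≡.trans (coeff-*P (s i p) (s i q) μ)
      (≡.trans (sumOver-map _ p _) (sumOver-cong p λ (a , d , α) →
        ≡.trans (sumOver-map _ q _) (sumOver-cong q λ (b , e , β) →
          ≡.cong (λ v → δ (d ℕ.+ e , v) μ (a ℚ.* b)) (≡.sym (swapExp-⊕ α β)))))))))

  s-1 : s i oneP ≋ oneP
  s-1 = ≡⇒≋ (≡.cong (λ v → (1ℚ , 0 , v) ∷ []) swapExp-replicate)

  s-isSemiringHomomorphism : IsSemiringHomomorphism (rawSemiringOf ring) (rawSemiringOf ring) (s i)
  s-isSemiringHomomorphism = record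
    { isNearSemiringHomomorphism = record
      { +-isMonoidHomomorphism = record
        { isMagmaHomomorphism = record { isRelHomomorphism = record { cong = s-cong } ; homo = s-+ }
        ; ε-homo = ≋-refl }
      ; *-homo = s-* }
    ; 1#-homo = s-1 }

  s-t : s i tP ≋ tP
  s-t = ≡⇒≋ (≡.cong (λ v → (1ℚ , 1 , v) ∷ []) swapExp-replicate)

  s-x : ∀ j → s i (x j) ≋ x (swapIdx i j)
  s-x j = ≡⇒≋ (≡.cong (λ v → (1ℚ , 0 , v) ∷ []) (swapExp-unitExp j))

-- The alphabets A_{k,m} and the operators T_i

-- the indices k, k+1, …, m-1 of the letters carrying the factor (1 - t)
range : ℕ → ℕ → List ℕ
range k m = map (k ℕ.+_) (upTo (m ∸ k))

range-self : ∀ k → range k k ≡ []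
range-self k = ≡.cong (map (k ℕ.+_) ∘ upTo) (ℕ.n∸n≡0 k)

range-suc : ∀ k i → k ≤ i → range k (suc i) ≡ range k i ++ i ∷ []
range-suc k i k≤i = begin
  map (k ℕ.+_) (upTo (suc i ∸ k))          ≡⟨ ≡.cong (map (k ℕ.+_) ∘ upTo) (ℕ.+-∸-assoc 1 k≤i) ⟩
  map (k ℕ.+_) (upTo (suc (i ∸ k)))        ≡⟨ ≡.cong (map (k ℕ.+_)) (List.upTo-∷ʳ (i ∸ k)) ⟨
  map (k ℕ.+_) (upTo (i ∸ k) ++ i ∸ k ∷ []) ≡⟨ List.map-++ (k ℕ.+_) (upTo (i ∸ k)) (i ∸ k ∷ []) ⟩
  range k i ++ k ℕ.+ (i ∸ k) ∷ []           ≡⟨ ≡.cong (λ j → range k i ++ j ∷ []) (ℕ.m+[n∸m]≡n k≤i) ⟩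
  range k i ++ i ∷ [] ∎
  where open ≡.≡-Reasoning

module Plethysm (n : ℕ) where

  open PolynomialRing n
  open RationalAlgebra commutativeRing constant-homo
  open NewtonSequences commutativeRing constant-homo
  open CommutativeRing commutativeRing using (setoid)
  open SetoidReasoning setoid

  ^P≡^ : ∀ (p : P) r → p ^P r ≡ p ^ r
  ^P≡^ p zero = ≡.refl
  ^P≡^ p (suc r) = ≡.cong (p *P_) (^P≡^ p r)

  downList : (ℕ → P) → ℕ → List P
  downList h zero = h zero ∷ []
  downList h (suc b) = h (suc b) ∷ downList h b

  hsA≡downList : ∀ k m b → hsA {n} k m b ≡ downList (hA k m) b
  hsA≡downList k m zero = ≡.refl
  hsA≡downList k m (suc b) = ≡.cong (hA k m (suc b) ∷_) (hsA≡downList k m b)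

  foldr-zipWith-newtonSum : ∀ p h b →
    List.foldr _+P_ zeroP (List.zipWith _*P_ (List.applyUpTo p (suc b)) (downList h b)) ≡ newtonSum p h (suc b)
  foldr-zipWith-newtonSum p h zero = ≡.refl
  foldr-zipWith-newtonSum p h (suc b) = ≡.cong (p 0 *P h (suc b) +P_) (foldr-zipWith-newtonSum (p ∘ suc) h b)

  powerSums : ℕ → ℕ → ℕ → P
  powerSums k m r = pA k m (suc r)

  hA-newton : ∀ k m → IsNewton (powerSums k m) (hA k m)
  hA-newton k m = record { initial = ≋-refl ; identity = identity }
    where
    identity : ∀ b → (b × oneP) *P hA k m b ≋ newtonSum (powerSums k m) (hA k m) b
    identity zero = ≋-refl
    identity (suc b) = begin
      N *P scale c Σ               ≈⟨ *-congˡ N (scale-constant c Σ) ⟩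
      N *P (constant c *P Σ)       ≈⟨ *-assoc N (constant c) Σ ⟨
      N *P constant c *P Σ         ≈⟨ *-cong (≋-trans (*-comm N (constant c)) (⟦1/[1+b]⟧*[1+b]≈1 b)) ≋-refl ⟩
      oneP *P Σ                    ≈⟨ *-identityˡ Σ ⟩
      Σ                            ≡⟨ ≡.cong₂ (λ ps hs → List.foldr _+P_ zeroP (List.zipWith _*P_ ps hs))
                                        (List.map-upTo (powerSums k m) (suc b)) (hsA≡downList k m b) ⟩
      List.foldr _+P_ zeroP (List.zipWith _*P_ (List.applyUpTo (powerSums k m) (suc b)) (downList (hA k m) b))
                                   ≡⟨ foldr-zipWith-newtonSum (powerSums k m) (hA k m) b ⟩
      newtonSum (powerSums k m) (hA k m) (suc b) ∎
      where
      N Σ : P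
      N = suc b × oneP
      Σ = List.foldr _+P_ zeroP (List.zipWith _*P_ (map (powerSums k m) (upTo (suc b))) (hsA k m b))
      c : ℚ
      c = (+ 1) ℚ./ suc b

  letters : ℕ → List ℕ → P
  letters r = List.foldr (λ j acc → x j ^P r +P acc) zeroP

  pA-expand : ∀ k m r → pA {n} k m r ≡ x m ^ r +P (oneP -P tP ^ r) *P letters r (range k m)
  pA-expand k m r = ≡.cong₂ (λ a b → a +P (oneP -P b) *P letters r (range k m)) (^P≡^ (x m) r) (^P≡^ tP r)

  letters-++ : ∀ r L L′ → letters r (L ++ L′) ≋ letters r L +P letters r L′
  letters-++ r [] L′ = ≋-refl
  letters-++ r (j ∷ L) L′ =
    ≋-trans (+-congˡ (x j ^P r) (letters-++ r L L′)) (≋-sym (+-assoc (x j ^P r) (letters r L) (letters r L′)))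

  letters-range-suc : ∀ k i r → k ≤ i → letters r (range k (suc i)) ≋ letters r (range k i) +P x i ^ r
  letters-range-suc k i r k≤i = ≋-trans (≡⇒≋ (≡.cong (letters r) (range-suc k i k≤i)))
    (≋-trans (letters-++ r (range k i) (i ∷ []))
      (+-congˡ (letters r (range k i)) (≋-trans (+-identityʳ (x i ^P r)) (≡⇒≋ (^P≡^ (x i) r)))))

  powerSums-base : ∀ k r → powerSums k k r ≋ x k ^ suc r
  powerSums-base k r = begin
    pA k k (suc r)                          ≡⟨ pA-expand k k (suc r) ⟩
    x k ^ suc r +P c *P letters (suc r) (range k k)
                                            ≡⟨ ≡.cong (λ L → x k ^ suc r +P c *P letters (suc r) L) (range-self k) ⟩
    x k ^ suc r +P c *P zeroP               ≈⟨ +-congˡ (x k ^ suc r) (zeroʳ c) ⟩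
    x k ^ suc r +P zeroP                    ≈⟨ +-identityʳ _ ⟩
    x k ^ suc r ∎
    where
    open CommutativeRing commutativeRing using (zeroʳ)
    c : P
    c = oneP -P tP ^ suc r

  powerSums-step : ∀ k i r → k ≤ i →
    powerSums k (suc i) r ≋ (powerSums k i r -P (tP *P x i) ^ suc r) +P x (suc i) ^ suc r
  powerSums-step k i r k≤i = begin
    pA k (suc i) (suc r)
      ≡⟨ pA-expand k (suc i) (suc r) ⟩
    x (suc i) ^ suc r +P (oneP -P tP ^ suc r) *P letters (suc r) (range k (suc i))
      ≈⟨ +-congˡ (x (suc i) ^ suc r) (*-congˡ (oneP -P tP ^ suc r) (letters-range-suc k i (suc r) k≤i)) ⟩
    x (suc i) ^ suc r +P (oneP -P tP ^ suc r) *P (letters (suc r) (range k i) +P x i ^ suc r)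
      ≈⟨ solve 4 (λ Y T S X → Y :+ (con 1ℚ :- T) :* (S :+ X)
                             := ((X :+ (con 1ℚ :- T) :* S) :- T :* X) :+ Y) ≋-refl
           (x (suc i) ^ suc r) (tP ^ suc r) (letters (suc r) (range k i)) (x i ^ suc r) ⟩
    (x i ^ suc r +P (oneP -P tP ^ suc r) *P letters (suc r) (range k i) -P tP ^ suc r *P x i ^ suc r)
      +P x (suc i) ^ suc r
      ≈⟨ +-congʳ (x (suc i) ^ suc r)
           (+-cong (≡⇒≋ (≡.sym (pA-expand k i (suc r)))) (-‿cong (≋-sym (^-distrib-* tP (x i) (suc r))))) ⟩
    (pA k i (suc r) -P (tP *P x i) ^ suc r) +P x (suc i) ^ suc r ∎
    where open CommutativeSemiringExp (CommutativeRing.commutativeSemiring commutativeRing) using (^-distrib-*)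

  module _ {i : ℕ} (1≤i : 1 ≤ i) (i<n : suc i ≤ n) where
    open Swap 1≤i i<n
    open SemiringExp (CommutativeRing.semiring commutativeRing) using (^-congˡ)
    open SemiringHomomorphismProperties (CommutativeRing.ring commutativeRing) (s i) s-isSemiringHomomorphism
      using (^-homo; -‿homo)

    s-letters : ∀ r L → All (_< i) L → s i (letters r L) ≋ letters r L
    s-letters r [] [] = ≋-refl
    s-letters r (j ∷ L) (j<i ∷ L<i) = ≋-trans (s-+ (x j ^P r) (letters r L)) (+-cong s-xʲ^r (s-letters r L L<i))
      where
      σj≡j : swapIdx i j ≡ j
      σj≡j = swapIdx-other i j (ℕ.<⇒≢ j<i) (ℕ.<⇒≢ (ℕ.m<n⇒m<1+n j<i))
      s-xʲ^r : s i (x j ^P r) ≋ x j ^P r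
      s-xʲ^r = begin
        s i (x j ^P r)   ≡⟨ ≡.cong (s i) (^P≡^ (x j) r) ⟩
        s i (x j ^ r)    ≈⟨ ^-homo (x j) r ⟩
        s i (x j) ^ r    ≈⟨ ^-congˡ r (≋-trans (s-x j) (≡⇒≋ (≡.cong x σj≡j))) ⟩
        x j ^ r          ≡⟨ ^P≡^ (x j) r ⟨
        x j ^P r ∎

    range-< : ∀ k → k ≤ i → All (_< i) (range k i)
    range-< k k≤i = ≡.subst (All (_< i)) (≡.sym (List.map-upTo (k ℕ.+_) (i ∸ k)))
      (AllProperties.applyUpTo⁺₁ (k ℕ.+_) (i ∸ k)
        (λ z<i∸k → ≡.subst (_ <_) (ℕ.m+[n∸m]≡n k≤i) (ℕ.+-monoʳ-< k z<i∸k)))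

    powerSums-swap : ∀ k r → k ≤ i →
      s i (powerSums k i r) ≋ (powerSums k i r -P x i ^ suc r) +P x (suc i) ^ suc r
    powerSums-swap k r k≤i = begin
      s i (pA k i (suc r))
        ≡⟨ ≡.cong (s i) (pA-expand k i (suc r)) ⟩
      s i (x i ^ suc r +P c *P L)
        ≈⟨ ≋-trans (s-+ (x i ^ suc r) (c *P L)) (+-cong (^-homo (x i) (suc r)) (s-* c L)) ⟩
      s i (x i) ^ suc r +P s i c *P s i L
        ≈⟨ +-cong (^-congˡ (suc r) (≋-trans (s-x i) (≡⇒≋ (≡.cong x (swapIdx-i i)))))
                  (*-cong s-c (s-letters (suc r) (range k i) (range-< k k≤i))) ⟩
      x (suc i) ^ suc r +P c *P L
        ≈⟨ solve 4 (λ Y T S X → Y :+ (con 1ℚ :- T) :* S := ((X :+ (con 1ℚ :- T) :* S) :- X) :+ Y) ≋-refl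
             (x (suc i) ^ suc r) (tP ^ suc r) L (x i ^ suc r) ⟩
      (x i ^ suc r +P c *P L -P x i ^ suc r) +P x (suc i) ^ suc r
        ≡⟨ ≡.cong (λ p → (p -P x i ^ suc r) +P x (suc i) ^ suc r) (pA-expand k i (suc r)) ⟨
      (pA k i (suc r) -P x i ^ suc r) +P x (suc i) ^ suc r ∎
      where
      c L : P
      c = oneP -P tP ^ suc r
      L = letters (suc r) (range k i)
      s-c : s i c ≋ c
      s-c = ≋-trans (s-+ oneP (-P (tP ^ suc r)))
        (+-cong s-1 (≋-trans (-‿homo (tP ^ suc r)) (-‿cong (≋-trans (^-homo tP (suc r)) (^-congˡ (suc r) s-t)))))

module DemazureLusztig (n k : ℕ) (1≤k : 1 ≤ k) where

  open PolynomialRing n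
  open RationalAlgebra commutativeRing constant-homo
  open NewtonSequences commutativeRing constant-homo
  open Plethysm n
  open CommutativeRing commutativeRing using (setoid)
  open SetoidReasoning setoid

  hA-base : ∀ b → x k ^P b ≋ hA k k b
  hA-base b = begin
    x k ^P b                                   ≡⟨ ^P≡^ (x k) b ⟩
    x k ^ b                                    ≈⟨ withLetter-emptyAlphabet (x k) b ⟨
    withLetter (x k) emptyAlphabet b           ≈⟨ newton-unique (λ r → ≋-sym (powerSums-base k r))
                                                    (withLetter-newton (x k) emptyAlphabet-newton) (hA-newton k k) b ⟩
    hA k k b ∎

  module Step {i : ℕ} (k≤i : k ≤ i) (i<n : suc i ≤ n) where

    1≤i : 1 ≤ i
    1≤i = ℕ.≤-trans 1≤k k≤i

    y xᵢ : P
    y = x (suc i)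
    xᵢ = x i

    hA-suc : ∀ b → hA k (suc i) b ≋ withLetter y (withoutLetter (tP *P xᵢ) (hA k i)) b
    hA-suc = newton-unique (λ r → powerSums-step k i r k≤i)
      (hA-newton k (suc i)) (withLetter-newton y (withoutLetter-newton (tP *P xᵢ) (hA-newton k i)))

    s-hA : ∀ b → s i (hA k i b) ≋ withLetter y (withoutLetter xᵢ (hA k i)) b
    s-hA = newton-unique (λ r → powerSums-swap 1≤i i<n k r k≤i)
      (newton-homo (s i) (Swap.s-isSemiringHomomorphism 1≤i i<n) (hA-newton k i))
      (withLetter-newton y (withoutLetter-newton xᵢ (hA-newton k i)))

    T-hA : ∀ {f} b → f ≋ hA k i b → TIs i f (hA k (suc i) b)
    T-hA {f} b f≋h = coeff-≡ (begin
      (y -P xᵢ) *P hA k (suc i) b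
        ≈⟨ *-congˡ (y -P xᵢ) (hA-suc b) ⟩
      (y -P xᵢ) *P withLetter y (withoutLetter (tP *P xᵢ) (hA k i)) b
        ≈⟨ letter-exchange xᵢ y (tP *P xᵢ) (hA k i) b ⟩
      (tP *P xᵢ -P xᵢ) *P hA k i b +P (y -P tP *P xᵢ) *P withLetter y (withoutLetter xᵢ (hA k i)) b
        ≈⟨ +-cong (≋-trans (*-congˡ (tP *P xᵢ -P xᵢ) (≋-sym f≋h)) ([ta-a]f≋[t-1]af tP xᵢ f))
                  (*-congˡ (y -P tP *P xᵢ) (≋-trans (≋-sym (s-hA b)) (Swap.s-cong 1≤i i<n (≋-sym f≋h)))) ⟩
      (tP -P oneP) *P xᵢ *P f +P (y -P tP *P xᵢ) *P s i f ∎)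
      where
      [ta-a]f≋[t-1]af : ∀ t a f → (t *P a -P a) *P f ≋ (t -P oneP) *P a *P f
      [ta-a]f≋[t-1]af = solve 3 (λ T A F → (T :* A :- A) :* F := (T :- con 1ℚ) :* A :* F) ≋-refl

  TChain-hA : ∀ {m} b c j {f} → k ≤ j → j ℕ.+ c ≡ m → m ≤ n → f ≋ hA k j b →
    TChain {n} j c f (hA k m b)
  TChain-hA {m} b zero j {f} _ j+0≡m _ f≋h =
    coeff-≡ (≡.subst (λ m → hA k m b ≋ f) (≡.trans (≡.sym (ℕ.+-identityʳ j)) j+0≡m) (≋-sym f≋h))
  TChain-hA {m} b (suc c) j k≤j j+1+c≡m m≤n f≋h =
    hA k (suc j) b , Step.T-hA k≤j j<n b f≋h , TChain-hA b c (suc j) (ℕ.m≤n⇒m≤1+n k≤j) 1+j+c≡m m≤n ≋-refl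
    where
    1+j+c≡m : suc j ℕ.+ c ≡ m
    1+j+c≡m = ≡.trans (≡.sym (ℕ.+-suc j c)) j+1+c≡m
    j<n : suc j ≤ n
    j<n = ℕ.≤-trans (ℕ.≤-trans (ℕ.m≤m+n (suc j) c) (ℕ.≤-reflexive 1+j+c≡m)) m≤n

lemma5p3 : (n k m b : ℕ) → 1 ≤ k → k ≤ m → m ≤ n →
    TChain {n} k (m ∸ k) (x k ^P b) (hA k m b)
lemma5p3 n k m b 1≤k k≤m m≤n = TChain-hA b (m ∸ k) k ℕ.≤-refl (ℕ.m+[n∸m]≡n k≤m) m≤n (hA-base b)
  where open DemazureLusztig n k 1≤k
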